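{- Let $k \geq 1$ be an integer. Then $$\mathrm{hc}(B_{2k}) = 2k\Big(2k^3+2k^2-\tfrac{11}{2}k+1\Big)+2, \qquad \mathrm{hc}(B_{2k+1}) = (2k+1)(2k^3+5k^2-2k-1)+2.$$
   Context: For a connected graph $G$ of order $n$, the detour distance $D(u,v)$ is the length of a longest $u$–$v$ path (in a tree, the ordinary distance). A hamiltonian coloring of $G$ is a map $h: V(G)\to\{0,1,2,\ldots\}$ with $D(u,v)+|h(u)-h(v)|\geq n-1$ for all distinct $u,v$; its span is $\max\{|h(u)-h(v)|\}$, and $\mathrm{hc}(G)$ is the minimum span over all hamiltonian colorings. The broom $B_{n,d}$ is the tree on $n$ vertices consisting of a path on $d$ vertices together with $n-d$ additional vertices all adjacent to the same end vertex of the path. Define $B_{2k} = B_{k(2k+1),\,2k}$ and $B_{2k+1} = B_{(k+1)(2k+1),\,2k+1}$. -}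

module Defs where

open import Data.Nat using (ℕ; zero; suc; _+_; _*_; _∸_; _≤_; _<_; ∣_-_∣)
open import Data.Fin using (Fin; toℕ)
open import Data.List using (List; []; _∷_; length)
open import Data.List.Relation.Unary.Unique.Propositional using (Unique)
open import Data.Product using (Σ; ∃; _×_; _,_)
open import Relation.Binary.PropositionalEquality using (_≡_; _≢_)

Graph : ℕ → Set₁
Graph n = Fin n → Fin n → Set

data Walk {n : ℕ} (G : Graph n) : Fin n → Fin n → List (Fin n) → Set where
  here : (v : Fin n) → Walk G v v (v ∷ [])
  step : {u w v : Fin n} {vs : List (Fin n)} →
         G u w → Walk G w v vs → Walk G u v (u ∷ vs)

IsPath : {n : ℕ} → Graph n → Fin n → Fin n → ℕ → List (Fin n) → Set
IsPath G u v m vs = Walk G u v vs × Unique vs × length vs ≡ suc m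

IsDetour : {n : ℕ} → Graph n → Fin n → Fin n → ℕ → Set
IsDetour G u v m =
  (Σ (List (Fin _)) λ vs → IsPath G u v m vs) ×
  (∀ m' vs → IsPath G u v m' vs → m' ≤ m)

IsHamiltonianColoring : {n : ℕ} → Graph n → (Fin n → ℕ) → Set
IsHamiltonianColoring {n} G h =
  ∀ u v → u ≢ v → ∀ m → IsDetour G u v m → n ∸ 1 ≤ m + ∣ h u - h v ∣

IsSpan : {n : ℕ} → (Fin n → ℕ) → ℕ → Set
IsSpan h s = (∀ u v → ∣ h u - h v ∣ ≤ s) × (∃ λ u → ∃ λ v → ∣ h u - h v ∣ ≡ s)

IsHc : {n : ℕ} → Graph n → ℕ → Set
IsHc G s =
  (Σ (Fin _ → ℕ) λ h → IsHamiltonianColoring G h × IsSpan h s) ×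
  (∀ h s' → IsHamiltonianColoring G h → IsSpan h s' → s ≤ s')

-- The broom B_{n,d} on vertex set Fin n: vertices 0,…,d-1 form the path
-- 0 - 1 - … - (d-1); every vertex j with j ≥ d is adjacent to the end vertex 0.
data BroomAdj (n d : ℕ) : Fin n → Fin n → Set where
  path-fwd : ∀ {i j} → toℕ j ≡ suc (toℕ i) → toℕ j < d → BroomAdj n d i j
  path-bwd : ∀ {i j} → toℕ i ≡ suc (toℕ j) → toℕ i < d → BroomAdj n d i j
  leaf-out : ∀ {i j} → toℕ i ≡ 0 → d ≤ toℕ j → BroomAdj n d i j
  leaf-in  : ∀ {i j} → d ≤ toℕ i → toℕ j ≡ 0 → BroomAdj n d i j

Broom : (n d : ℕ) → Graph n
Broom n d = BroomAdj n d

B-even : (k : ℕ) → Graph (k * (2 * k + 1))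
B-even k = Broom (k * (2 * k + 1)) (2 * k)

B-odd : (k : ℕ) → Graph ((k + 1) * (2 * k + 1))
B-odd k = Broom ((k + 1) * (2 * k + 1)) (2 * k + 1)

-- The broom is a tree, so detour distance is ordinary distance, and the distance of two
-- vertices is at most the sum of their levels (distances to the root carrying the leaves).
-- Listing the vertices by increasing colour, consecutive colours differ by at least
-- (n-1) - D, and summing along the list gives span ≥ (n-1)² + 1 - 2 Σ level.  The bound is
-- attained by colouring the path vertices alternately with leaves, then the remaining
-- leaves: consecutive vertices are then joined through the root, and when n > 2d any two
-- non-consecutive vertices are two large gaps apart.
module Submission where

open import Defs

module Brooms where

  open import Data.Nat using (ℕ; zero; suc; _+_; _*_; _∸_; _≤_; _<_; _≥_; z≤n; s≤s; s≤s⁻¹; ∣_-_∣; _<?_; _≤?_; _≟_)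
  open import Data.Nat.Properties
  open import Data.Nat.ListAction using (sum)
  open import Data.Nat.ListAction.Properties using (sum-↭; sum-++)
  open import Data.Nat.Tactic.RingSolver using (solve-∀)
  open import Data.Fin using (Fin; toℕ; fromℕ; fromℕ<) renaming (zero to fzero)
  open import Data.Fin.Properties using (toℕ-injective; toℕ-fromℕ<; toℕ-fromℕ; toℕ<n; all?) renaming (_≟_ to _≟ᶠ_)
  open import Data.Vec using (lookup; []; _∷_)
  open import Data.List using (List; []; _∷_; _∷ʳ_; length; map; allFin; tabulate; applyUpTo)
  open import Data.List.Properties using (length-tabulate; applyUpTo-∷ʳ; map-tabulate)
  open import Data.List.Membership.Propositional using (_∈_; _∉_)
  open import Data.List.Relation.Unary.All as All using (All; []; _∷_)
  open import Data.List.Relation.Unary.AllPairs using ([]; _∷_)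
  open import Data.List.Relation.Unary.Any using (here; there)
  open import Data.List.Relation.Unary.Linked using (Linked; []; _∷_)
  open import Data.List.Relation.Unary.Unique.Propositional using (Unique)
  open import Data.List.Relation.Unary.Unique.Propositional.Properties using (allFin⁺)
  open import Data.List.Relation.Binary.Permutation.Propositional using (_↭_; ↭⇒↭ₛ; ↭-sym)
  open import Data.List.Relation.Binary.Permutation.Propositional.Properties using (↭-length; map⁺)
  open import Data.List.Relation.Binary.Permutation.Setoid.Properties using (Unique-resp-↭)
  open import Data.Product using (Σ; ∃-syntax; _×_; _,_; proj₁)
  open import Data.Sum using (_⊎_; inj₁; inj₂)
  open import Data.Empty using (⊥-elim)
  open import Function using (_∘_; id)
  open import Relation.Nullary using (Dec; yes; no; contradiction; ¬?)
  open import Relation.Nullary.Decidable using (_→-dec_; True; toWitness)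
  open import Relation.Binary.Definitions using (tri<; tri≈; tri>)
  open import Relation.Binary.PropositionalEquality
  open import Relation.Binary.PropositionalEquality.Properties using (setoid)
  import Relation.Binary.Construct.On as On

  m<n⇒1+∣1+m-n∣≡∣m-n∣ : ∀ {m n} → m < n → suc ∣ suc m - n ∣ ≡ ∣ m - n ∣
  m<n⇒1+∣1+m-n∣≡∣m-n∣ {zero}  {suc zero}    _         = refl
  m<n⇒1+∣1+m-n∣≡∣m-n∣ {zero}  {suc (suc n)} _         = refl
  m<n⇒1+∣1+m-n∣≡∣m-n∣ {suc m} {suc n}       (s≤s m<n) = m<n⇒1+∣1+m-n∣≡∣m-n∣ m<n

  n≤m⇒∣1+m-n∣≡1+∣m-n∣ : ∀ {m n} → n ≤ m → ∣ suc m - n ∣ ≡ suc ∣ m - n ∣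
  n≤m⇒∣1+m-n∣≡1+∣m-n∣ {zero}  {zero}  _         = refl
  n≤m⇒∣1+m-n∣≡1+∣m-n∣ {suc m} {zero}  _         = refl
  n≤m⇒∣1+m-n∣≡1+∣m-n∣ {suc m} {suc n} (s≤s n≤m) = n≤m⇒∣1+m-n∣≡1+∣m-n∣ n≤m

  tabulate-toℕ : ∀ {A : Set} n (f : ℕ → A) → tabulate {n = n} (f ∘ toℕ) ≡ applyUpTo f n
  tabulate-toℕ zero    f = refl
  tabulate-toℕ (suc n) f = cong (f 0 ∷_) (tabulate-toℕ n (f ∘ suc))

  sum-applyUpTo-suc : ∀ (f : ℕ → ℕ) n → sum (applyUpTo f (suc n)) ≡ sum (applyUpTo f n) + f n
  sum-applyUpTo-suc f n = begin
    sum (applyUpTo f (suc n))        ≡⟨ cong sum (sym (applyUpTo-∷ʳ f n)) ⟩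
    sum (applyUpTo f n ∷ʳ f n)       ≡⟨ sum-++ (applyUpTo f n) (f n ∷ []) ⟩
    sum (applyUpTo f n) + (f n + 0)  ≡⟨ cong (sum (applyUpTo f n) +_) (+-identityʳ (f n)) ⟩
    sum (applyUpTo f n) + f n        ∎
    where open ≡-Reasoning

  -- If the ends of every edge are at distances from v differing by one and every u ≠ v has
  -- exactly one neighbour closer to v, then every path is a geodesic: read backwards from v,
  -- each step of a repetition-free path moves one further from v, since the only neighbour
  -- closer to v is the vertex the path has just come from.
  module TreeDetour {n : ℕ} (G : Graph n) (δ : Fin n → Fin n → ℕ)
    (G-sym : ∀ {u w} → G u w → G w u)
    (δ-refl : ∀ v → δ v v ≡ 0)
    (δ-adjacent : ∀ {a x} → G a x → ∀ v → δ x v ≡ suc (δ a v) ⊎ suc (δ x v) ≡ δ a v)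
    (closer-unique : ∀ {a x w} v → G a x → G a w →
                     suc (δ x v) ≡ δ a v → suc (δ w v) ≡ δ a v → x ≡ w)
    (closer-exists : ∀ {u v} → u ≢ v → ∃[ x ] G u x × suc (δ x v) ≡ δ u v)
    where

    private
      head∈ : ∀ {w v vs} → Walk G w v vs → w ∈ vs
      head∈ (here _)   = here refl
      head∈ (step _ _) = here refl

      All≢⇒∉ : ∀ {u : Fin n} {vs} → All (u ≢_) vs → u ∉ vs
      All≢⇒∉ (u≢v ∷ _)  (here u≡v) = u≢v u≡v
      All≢⇒∉ (_ ∷ u∉vs) (there u∈vs) = All≢⇒∉ u∉vs u∈vs

    -- The second component is the strengthening that makes the induction go through.
    Geodesic : Fin n → Fin n → List (Fin n) → Set
    Geodesic w v vs =
      length vs ≡ suc (δ w v) × (∀ u → G w u → u ∉ vs → δ u v ≡ suc (δ w v))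

    unique-walk-geodesic : ∀ {w v vs} → Walk G w v vs → Unique vs → Geodesic w v vs
    unique-walk-geodesic (here v) _ = cong suc (sym (δ-refl v)) , neighbour-farther
      where
      neighbour-farther : ∀ u → G v u → u ∉ v ∷ [] → δ u v ≡ suc (δ v v)
      neighbour-farther u vu _ with δ-adjacent vu v
      ... | inj₁ farther = farther
      ... | inj₂ closer  = ⊥-elim (1+n≢0 (trans closer (δ-refl v)))
    unique-walk-geodesic {u} {v} {.u ∷ vs} (step {w = w} uw walk) (u∉vs ∷ unique)
      with unique-walk-geodesic walk unique
    ... | length≡ , w-outward = trans (cong suc length≡) (cong suc (sym u-farther)) , u-outward
      where
      u-farther : δ u v ≡ suc (δ w v)
      u-farther = w-outward u (G-sym uw) (All≢⇒∉ u∉vs)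
      u-outward : ∀ x → G u x → x ∉ u ∷ vs → δ x v ≡ suc (δ u v)
      u-outward x ux x∉ with δ-adjacent ux v
      ... | inj₁ farther = farther
      ... | inj₂ closer  = ⊥-elim (x∉ (there (subst (_∈ vs) (sym x≡w) (head∈ walk))))
        where
        x≡w : x ≡ w
        x≡w = closer-unique v ux uw closer (sym u-farther)

    path-length : ∀ {u v m vs} → IsPath G u v m vs → m ≡ δ u v
    path-length (walk , unique , length≡) =
      suc-injective (trans (sym length≡) (proj₁ (unique-walk-geodesic walk unique)))

    descending-walk : ∀ m u v → δ u v ≡ m →
      Σ (List (Fin n)) λ vs → Walk G u v vs × Unique vs × All (λ y → δ y v ≤ m) vs
    descending-walk m u v δ≡m with u ≟ᶠ v
    ... | yes refl = u ∷ [] , here u , [] ∷ [] , ≤-reflexive δ≡m ∷ []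
    ... | no u≢v with closer-exists u≢v
    descending-walk zero    u v δ≡0 | no _ | x , _ , closer = ⊥-elim (1+n≢0 (trans closer δ≡0))
    descending-walk (suc m) u v δ≡m | no _ | x , ux , closer
      with descending-walk m x v (suc-injective (trans closer δ≡m))
    ... | vs , walk , unique , below =
      u ∷ vs , step ux walk , All.map u-not-below below ∷ unique , ≤-reflexive δ≡m ∷ All.map m≤n⇒m≤1+n below
      where
      u-not-below : ∀ {y} → δ y v ≤ m → u ≢ y
      u-not-below y-below refl = <⇒≱ (≤-reflexive (sym δ≡m)) y-below

    isDetour : ∀ u v → IsDetour G u v (δ u v)
    isDetour u v with descending-walk (δ u v) u v refl
    ... | vs , walk , unique , _ =
      (vs , walk , unique , proj₁ (unique-walk-geodesic walk unique)) ,
      λ _ _ path → ≤-reflexive (path-length path)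

    detour-unique : ∀ {u v m} → IsDetour G u v m → m ≡ δ u v
    detour-unique ((_ , path) , _) = path-length path

  -- For any ℓ with δ a b ≤ ℓ a + ℓ b (e.g. the distance from a fixed root), list the
  -- vertices by increasing colour: consecutive colours differ by at least (n-1) - δ,
  -- and the δ's along the list sum to at most 2 Σ ℓ - ℓ(first) - ℓ(last).
  module LowerBound {n : ℕ} (G : Graph n) (δ : Fin n → Fin n → ℕ)
    (isDetour : ∀ u v → IsDetour G u v (δ u v))
    (ℓ : Fin n → ℕ)
    (δ≤ℓ+ℓ : ∀ a b → δ a b ≤ ℓ a + ℓ b)
    (ℓ≡0-unique : ∀ {a b} → ℓ a ≡ 0 → ℓ b ≡ 0 → a ≡ b)
    where

    lastOf : Fin n → List (Fin n) → Fin n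
    lastOf x []       = x
    lastOf _ (y ∷ ys) = lastOf y ys

    lastOf∈ : ∀ y ys → lastOf y ys ∈ y ∷ ys
    lastOf∈ y []       = here refl
    lastOf∈ _ (z ∷ zs) = there (lastOf∈ z zs)

    δ-along : Fin n → List (Fin n) → ℕ
    δ-along _ []       = 0
    δ-along x (y ∷ ys) = δ x y + δ-along y ys

    Σℓ : List (Fin n) → ℕ
    Σℓ xs = sum (map ℓ xs)

    δ-along-bound : ∀ x ys → δ-along x ys + ℓ x + ℓ (lastOf x ys) ≤ 2 * (ℓ x + Σℓ ys)
    δ-along-bound x [] = ≤-reflexive (double (ℓ x))
      where
      double : ∀ a → a + a ≡ 2 * (a + 0)
      double = solve-∀
    δ-along-bound x (y ∷ ys) = +-cancelˡ-≤ (ℓ y) _ _ (begin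
      ℓ y + (δ x y + δ-along y ys + ℓ x + ℓ l)  ≡⟨ shuffle (ℓ y) (δ x y) (δ-along y ys) (ℓ x) (ℓ l) ⟩
      δ x y + ℓ x + (δ-along y ys + ℓ y + ℓ l)  ≤⟨ +-mono-≤ (+-monoˡ-≤ (ℓ x) (δ≤ℓ+ℓ x y)) (δ-along-bound y ys) ⟩
      ℓ x + ℓ y + ℓ x + 2 * (ℓ y + Σℓ ys)       ≡⟨ regroup (ℓ x) (ℓ y) (Σℓ ys) ⟩
      ℓ y + 2 * (ℓ x + (ℓ y + Σℓ ys))           ∎)
      where
      open ≤-Reasoning
      l = lastOf y ys
      shuffle : ∀ a b c e f → a + (b + c + e + f) ≡ b + e + (c + a + f)
      shuffle = solve-∀
      regroup : ∀ a b c → a + b + a + 2 * (b + c) ≡ b + 2 * (a + (b + c))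
      regroup = solve-∀

    module _ {h : Fin n → ℕ} (ham : IsHamiltonianColoring G h) where

      _≤ʰ_ : Fin n → Fin n → Set
      a ≤ʰ b = h a ≤ h b

      colour-gap : ∀ {a b} → a ≢ b → h a ≤ h b → h a + (n ∸ 1) ≤ h b + δ a b
      colour-gap {a} {b} a≢b ha≤hb = begin
        h a + (n ∸ 1)                  ≤⟨ +-monoʳ-≤ (h a) (ham a b a≢b (δ a b) (isDetour a b)) ⟩
        h a + (δ a b + ∣ h a - h b ∣)  ≡⟨ cong (λ z → h a + (δ a b + z)) (m≤n⇒∣m-n∣≡n∸m ha≤hb) ⟩
        h a + (δ a b + (h b ∸ h a))    ≡⟨ +-comm-middle (h a) (δ a b) (h b ∸ h a) ⟩
        h a + (h b ∸ h a) + δ a b      ≡⟨ cong (_+ δ a b) (m+[n∸m]≡n ha≤hb) ⟩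
        h b + δ a b                    ∎
        where
        open ≤-Reasoning
        +-comm-middle : ∀ a b c → a + (b + c) ≡ a + c + b
        +-comm-middle = solve-∀

      sorted-increasing : ∀ x ys → Linked _≤ʰ_ (x ∷ ys) → h x ≤ h (lastOf x ys)
      sorted-increasing x []       _             = ≤-refl
      sorted-increasing x (y ∷ ys) (x≤y ∷ sorted) = ≤-trans x≤y (sorted-increasing y ys sorted)

      telescope : ∀ x ys → Linked _≤ʰ_ (x ∷ ys) → Unique (x ∷ ys) →
                  h x + length ys * (n ∸ 1) ≤ h (lastOf x ys) + δ-along x ys
      telescope x [] _ _ = ≤-refl
      telescope x (y ∷ ys) (x≤y ∷ sorted) ((x≢y ∷ _) ∷ unique) = begin
        h x + ((n ∸ 1) + length ys * (n ∸ 1))  ≡⟨ sym (+-assoc (h x) _ _) ⟩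
        h x + (n ∸ 1) + length ys * (n ∸ 1)    ≤⟨ +-monoˡ-≤ _ (colour-gap x≢y x≤y) ⟩
        h y + δ x y + length ys * (n ∸ 1)      ≡⟨ +-right-swap (h y) (δ x y) _ ⟩
        h y + length ys * (n ∸ 1) + δ x y      ≤⟨ +-monoˡ-≤ (δ x y) (telescope y ys sorted unique) ⟩
        h l + δ-along y ys + δ x y             ≡⟨ +-rotate (h l) (δ-along y ys) (δ x y) ⟩
        h l + (δ x y + δ-along y ys)           ∎
        where
        open ≤-Reasoning
        l = lastOf y ys
        +-right-swap : ∀ a b c → a + b + c ≡ a + c + b
        +-right-swap = solve-∀
        +-rotate : ∀ a b c → a + b + c ≡ a + (c + b)
        +-rotate = solve-∀

      sorted-span-bound : ∀ {s} x y ys → IsSpan h s → Linked _≤ʰ_ (x ∷ y ∷ ys) → Unique (x ∷ y ∷ ys) →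
                          suc (length (y ∷ ys) * (n ∸ 1)) ≤ s + 2 * Σℓ (x ∷ y ∷ ys)
      sorted-span-bound {s} x y ys (bounded , _) sorted unique@(x≢rest ∷ _) = +-cancelˡ-≤ (h x) _ _ (begin
        h x + suc (k * (n ∸ 1))          ≡⟨ +-suc (h x) _ ⟩
        suc (h x + k * (n ∸ 1))          ≡⟨ +-comm 1 _ ⟩
        h x + k * (n ∸ 1) + 1            ≤⟨ +-monoʳ-≤ (h x + k * (n ∸ 1)) root-at-most-once ⟩
        h x + k * (n ∸ 1) + (ℓ x + ℓ l)  ≤⟨ +-monoˡ-≤ _ (telescope x (y ∷ ys) sorted unique) ⟩
        h l + Δ + (ℓ x + ℓ l)            ≤⟨ +-monoˡ-≤ _ (+-monoˡ-≤ Δ hl≤hx+s) ⟩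
        h x + s + Δ + (ℓ x + ℓ l)        ≡⟨ regroup (h x) s Δ (ℓ x) (ℓ l) ⟩
        h x + (s + (Δ + ℓ x + ℓ l))      ≤⟨ +-monoʳ-≤ (h x) (+-monoʳ-≤ s (δ-along-bound x (y ∷ ys))) ⟩
        h x + (s + 2 * Σℓ (x ∷ y ∷ ys))  ∎)
        where
        open ≤-Reasoning
        k = length (y ∷ ys)
        l = lastOf y ys
        Δ = δ-along x (y ∷ ys)
        regroup : ∀ a b c e f → a + b + c + (e + f) ≡ a + (b + (c + e + f))
        regroup = solve-∀
        hx≤hl : h x ≤ h l
        hx≤hl = sorted-increasing x (y ∷ ys) sorted
        hl≤hx+s : h l ≤ h x + s
        hl≤hx+s = begin
          h l                  ≡⟨ sym (m+[n∸m]≡n hx≤hl) ⟩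
          h x + (h l ∸ h x)    ≡⟨ cong (h x +_) (sym (m≤n⇒∣m-n∣≡n∸m hx≤hl)) ⟩
          h x + ∣ h x - h l ∣  ≤⟨ +-monoʳ-≤ (h x) (bounded x l) ⟩
          h x + s              ∎
        root-at-most-once : 1 ≤ ℓ x + ℓ l
        root-at-most-once with ℓ x in ℓx≡ | ℓ l in ℓl≡
        ... | suc _ | _     = s≤s z≤n
        ... | zero  | suc _ = s≤s z≤n
        ... | zero  | zero  = contradiction (ℓ≡0-unique ℓx≡ ℓl≡) (All.lookup x≢rest (lastOf∈ y ys))

      span-lower-bound : ∀ {s} → 2 ≤ n → IsSpan h s → suc ((n ∸ 1) * (n ∸ 1)) ≤ s + 2 * Σℓ (allFin n)
      span-lower-bound {s} 2≤n span = bound (sort (allFin n)) (sort-↗ (allFin n)) (sort-↭ (allFin n))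
        where
        open import Data.List.Sort (On.decTotalOrder ≤-decTotalOrder h) using (sort; sort-↗; sort-↭)

        length≡ : ∀ {xs} → xs ↭ allFin n → length xs ≡ n
        length≡ xs↭ = trans (↭-length xs↭) (length-tabulate id)

        bound : ∀ xs → Linked _≤ʰ_ xs → xs ↭ allFin n → suc ((n ∸ 1) * (n ∸ 1)) ≤ s + 2 * Σℓ (allFin n)
        bound [] _ xs↭ with () ← subst (2 ≤_) (sym (length≡ xs↭)) 2≤n
        bound (_ ∷ []) _ xs↭ with s≤s () ← subst (2 ≤_) (sym (length≡ xs↭)) 2≤n
        bound (x ∷ y ∷ ys) sorted xs↭ =
          subst₂ (λ k σ → suc (k * (n ∸ 1)) ≤ s + 2 * σ)
            (cong (_∸ 1) (length≡ xs↭)) (sum-↭ (map⁺ ℓ xs↭))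
            (sorted-span-bound x y ys span sorted unique)
          where
          unique : Unique (x ∷ y ∷ ys)
          unique = Unique-resp-↭ (setoid (Fin n)) (↭⇒↭ₛ (↭-sym xs↭)) (allFin⁺ n)

  data Adj (d : ℕ) : ℕ → ℕ → Set where
    path-fwd : ∀ {i j} → j ≡ suc i → j < d → Adj d i j
    path-bwd : ∀ {i j} → i ≡ suc j → i < d → Adj d i j
    leaf-out : ∀ {i j} → i ≡ 0 → d ≤ j → Adj d i j
    leaf-in  : ∀ {i j} → d ≤ i → j ≡ 0 → Adj d i j

  fromBroomAdj : ∀ {n d} {u w : Fin n} → BroomAdj n d u w → Adj d (toℕ u) (toℕ w)
  fromBroomAdj (path-fwd e l) = path-fwd e l
  fromBroomAdj (path-bwd e l) = path-bwd e l
  fromBroomAdj (leaf-out e l) = leaf-out e l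
  fromBroomAdj (leaf-in l e)  = leaf-in l e

  toBroomAdj : ∀ {n d} {u w : Fin n} → Adj d (toℕ u) (toℕ w) → BroomAdj n d u w
  toBroomAdj (path-fwd e l) = path-fwd e l
  toBroomAdj (path-bwd e l) = path-bwd e l
  toBroomAdj (leaf-out e l) = leaf-out e l
  toBroomAdj (leaf-in l e)  = leaf-in l e

  Adj-sym : ∀ {d a b} → Adj d a b → Adj d b a
  Adj-sym (path-fwd e l) = path-bwd e l
  Adj-sym (path-bwd e l) = path-fwd e l
  Adj-sym (leaf-out e l) = leaf-in l e
  Adj-sym (leaf-in l e)  = leaf-out e l

  -- Distance from the root 0, the end of the path carrying the leaves.
  level : ℕ → ℕ → ℕ
  level d a with a <? d
  ... | yes _ = a
  ... | no _  = 1

  dist : ℕ → ℕ → ℕ → ℕ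
  dist d a b with a <? d | b <? d
  ... | yes _ | yes _ = ∣ a - b ∣
  ... | yes _ | no _  = suc a
  ... | no _  | yes _ = suc b
  ... | no _  | no _  with a ≟ b
  ...   | yes _ = 0
  ...   | no _  = 2

  module _ {d : ℕ} where

    level-path : ∀ {a} → a < d → level d a ≡ a
    level-path {a} a<d with a <? d
    ... | yes _   = refl
    ... | no a≮d = contradiction a<d a≮d

    level-leaf : ∀ {a} → d ≤ a → level d a ≡ 1
    level-leaf {a} d≤a with a <? d
    ... | yes a<d = contradiction d≤a (<⇒≱ a<d)
    ... | no _    = refl

    level≡0⇒≡0 : ∀ a → level d a ≡ 0 → a ≡ 0
    level≡0⇒≡0 a level≡0 with a <? d
    ... | yes _ = level≡0

    dist-path-path : ∀ {a b} → a < d → b < d → dist d a b ≡ ∣ a - b ∣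
    dist-path-path {a} {b} a<d b<d with a <? d | b <? d
    ... | yes _   | yes _   = refl
    ... | no a≮d | _       = contradiction a<d a≮d
    ... | yes _   | no b≮d = contradiction b<d b≮d

    dist-path-leaf : ∀ {a b} → a < d → d ≤ b → dist d a b ≡ suc a
    dist-path-leaf {a} {b} a<d d≤b with a <? d | b <? d
    ... | yes _   | yes b<d = contradiction d≤b (<⇒≱ b<d)
    ... | yes _   | no _    = refl
    ... | no a≮d | _       = contradiction a<d a≮d

    dist-leaf-path : ∀ {a b} → d ≤ a → b < d → dist d a b ≡ suc b
    dist-leaf-path {a} {b} d≤a b<d with a <? d | b <? d
    ... | yes a<d | _       = contradiction d≤a (<⇒≱ a<d)
    ... | no _    | yes _   = refl
    ... | no _    | no b≮d = contradiction b<d b≮d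

    dist-leaf-leaf : ∀ {a b} → d ≤ a → d ≤ b → a ≢ b → dist d a b ≡ 2
    dist-leaf-leaf {a} {b} d≤a d≤b a≢b with a <? d | b <? d
    ... | yes a<d | _       = contradiction d≤a (<⇒≱ a<d)
    ... | no _    | yes b<d = contradiction d≤b (<⇒≱ b<d)
    ... | no _    | no _    with a ≟ b
    ...   | yes a≡b = contradiction a≡b a≢b
    ...   | no _    = refl

    dist-refl : ∀ a → dist d a a ≡ 0
    dist-refl a with a <? d
    ... | yes _ = ∣n-n∣≡0 a
    ... | no _  with a ≟ a
    ...   | yes _   = refl
    ...   | no a≢a = contradiction refl a≢a

    dist-sym : ∀ a b → dist d a b ≡ dist d b a
    dist-sym a b with a <? d | b <? d
    ... | yes _ | yes _ = ∣-∣-comm a b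
    ... | yes _ | no _  = refl
    ... | no _  | yes _ = refl
    ... | no _  | no _  with a ≟ b | b ≟ a
    ...   | yes _   | yes _   = refl
    ...   | no _    | no _    = refl
    ...   | yes a≡b | no b≢a = contradiction (sym a≡b) b≢a
    ...   | no a≢b | yes b≡a = contradiction (sym b≡a) a≢b

    dist≡0⇒≡ : ∀ {a b} → dist d a b ≡ 0 → a ≡ b
    dist≡0⇒≡ {a} {b} dist≡0 with a <? d | b <? d
    ... | yes _ | yes _ = ∣m-n∣≡0⇒m≡n dist≡0
    ... | no _  | no _  with a ≟ b
    ...   | yes a≡b = a≡b

    dist≤level+level : ∀ a b → dist d a b ≤ level d a + level d b
    dist≤level+level a b with a <? d | b <? d
    ... | yes _ | yes _ = ≤-trans (∣m-n∣≤m⊔n a b) (m⊔n≤m+n a b)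
    ... | yes _ | no _  = ≤-reflexive (+-comm 1 a)
    ... | no _  | yes _ = ≤-refl
    ... | no _  | no _  with a ≟ b
    ...   | yes _ = z≤n
    ...   | no _  = ≤-refl

    dist≤d : 2 ≤ d → ∀ a b → dist d a b ≤ d
    dist≤d 2≤d a b with a <? d | b <? d
    ... | yes a<d | yes b<d = ≤-trans (∣m-n∣≤m⊔n a b) (⊔-lub (<⇒≤ a<d) (<⇒≤ b<d))
    ... | yes a<d | no _    = a<d
    ... | no _    | yes b<d = b<d
    ... | no _    | no _    with a ≟ b
    ...   | yes _ = z≤n
    ...   | no _  = 2≤d

  path-or-leaf : ∀ d v → v < d ⊎ d ≤ v
  path-or-leaf d v with v <? d
  ... | yes v<d = inj₁ v<d
  ... | no v≮d  = inj₂ (≮⇒≥ v≮d)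

  -- The neighbour of a on the way to v.
  towards : ℕ → ℕ → ℕ → ℕ
  towards d a v with path-or-leaf d a
  ... | inj₂ _ = 0
  ... | inj₁ _ with path-or-leaf d v | a
  ...   | inj₂ _ | zero  = v
  ...   | inj₂ _ | suc b = b
  ...   | inj₁ _ | _     with ≤-<-connex v a
  ...     | inj₁ _ = a ∸ 1
  ...     | inj₂ _ = suc a

  private
    2+n≢n : ∀ {n} → suc (suc n) ≢ n
    2+n≢n {suc n} = 2+n≢n ∘ suc-injective

  module _ {d : ℕ} (0<d : 0 < d) where

    dist-adjacent : ∀ {a x} → Adj d a x → ∀ v →
                    dist d x v ≡ suc (dist d a v) ⊎ suc (dist d x v) ≡ dist d a v
    dist-adjacent {a} (path-fwd refl x<d) v with path-or-leaf d v
    ... | inj₂ d≤v rewrite dist-path-leaf x<d d≤v | dist-path-leaf (<-trans (n<1+n a) x<d) d≤v = inj₁ refl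
    ... | inj₁ v<d rewrite dist-path-path x<d v<d | dist-path-path (<-trans (n<1+n a) x<d) v<d
        with ≤-<-connex v a
    ...   | inj₁ v≤a = inj₁ (n≤m⇒∣1+m-n∣≡1+∣m-n∣ v≤a)
    ...   | inj₂ a<v = inj₂ (m<n⇒1+∣1+m-n∣≡∣m-n∣ a<v)
    dist-adjacent {x = x} (path-bwd refl a<d) v with path-or-leaf d v
    ... | inj₂ d≤v rewrite dist-path-leaf a<d d≤v | dist-path-leaf (<-trans (n<1+n x) a<d) d≤v = inj₂ refl
    ... | inj₁ v<d rewrite dist-path-path a<d v<d | dist-path-path (<-trans (n<1+n x) a<d) v<d
        with ≤-<-connex v x
    ...   | inj₁ v≤x = inj₂ (sym (n≤m⇒∣1+m-n∣≡1+∣m-n∣ v≤x))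
    ...   | inj₂ x<v = inj₁ (sym (m<n⇒1+∣1+m-n∣≡∣m-n∣ x<v))
    dist-adjacent {x = x} (leaf-out refl d≤x) v with path-or-leaf d v
    ... | inj₁ v<d rewrite dist-leaf-path d≤x v<d | dist-path-path 0<d v<d = inj₁ refl
    ... | inj₂ d≤v with x ≟ v
    ...   | yes refl rewrite dist-refl {d} x | dist-path-leaf 0<d d≤x = inj₂ refl
    ...   | no x≢v rewrite dist-leaf-leaf d≤x d≤v x≢v | dist-path-leaf 0<d d≤v = inj₁ refl
    dist-adjacent {a} (leaf-in d≤a refl) v with path-or-leaf d v
    ... | inj₁ v<d rewrite dist-leaf-path d≤a v<d | dist-path-path 0<d v<d = inj₂ refl
    ... | inj₂ d≤v with a ≟ v
    ...   | yes refl rewrite dist-refl {d} a | dist-path-leaf 0<d d≤a = inj₁ refl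
    ...   | no a≢v rewrite dist-leaf-leaf d≤a d≤v a≢v | dist-path-leaf 0<d d≤v = inj₂ refl


    closer⇒towards : ∀ {a x} → Adj d a x → ∀ v → suc (dist d x v) ≡ dist d a v → x ≡ towards d a v
    closer⇒towards {a} (path-fwd refl x<d) v closer with path-or-leaf d a
    ... | inj₂ d≤a = contradiction d≤a (<⇒≱ (<-trans (n<1+n a) x<d))
    ... | inj₁ a<d with path-or-leaf d v
    ...   | inj₂ d≤v rewrite dist-path-leaf x<d d≤v | dist-path-leaf a<d d≤v = contradiction closer 2+n≢n
    ...   | inj₁ v<d with ≤-<-connex v a
    ...     | inj₂ _   = refl
    ...     | inj₁ v≤a rewrite dist-path-path x<d v<d | dist-path-path a<d v<d
                             | n≤m⇒∣1+m-n∣≡1+∣m-n∣ v≤a = contradiction closer 2+n≢n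
    closer⇒towards {x = x} (path-bwd refl a<d) v closer with path-or-leaf d (suc x)
    ... | inj₂ d≤a = contradiction d≤a (<⇒≱ a<d)
    ... | inj₁ _ with path-or-leaf d v
    ...   | inj₂ _   = refl
    ...   | inj₁ v<d with ≤-<-connex v (suc x)
    ...     | inj₁ _   = refl
    ...     | inj₂ a<v rewrite dist-path-path a<d v<d | dist-path-path (<-trans (n<1+n x) a<d) v<d =
            contradiction (trans (cong suc closer) (m<n⇒1+∣1+m-n∣≡∣m-n∣ (<-trans (n<1+n x) a<v))) 2+n≢n
    closer⇒towards {x = x} (leaf-out refl d≤x) v closer with path-or-leaf d 0
    ... | inj₂ d≤0 = contradiction d≤0 (<⇒≱ 0<d)
    ... | inj₁ _ with path-or-leaf d v
    ...   | inj₂ d≤v rewrite dist-path-leaf 0<d d≤v = dist≡0⇒≡ {d} (suc-injective closer)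
    ...   | inj₁ v<d rewrite dist-leaf-path d≤x v<d | dist-path-path 0<d v<d = contradiction closer 2+n≢n
    closer⇒towards {a} (leaf-in d≤a refl) v closer with path-or-leaf d a
    ... | inj₂ _   = refl
    ... | inj₁ a<d = contradiction d≤a (<⇒≱ a<d)

    closer-exists : ∀ {n a b} → a < n → b < n → a ≢ b →
                    ∃[ x ] x < n × Adj d a x × suc (dist d x b) ≡ dist d a b
    closer-exists {n} {a} {b} a<n b<n a≢b with path-or-leaf d a | path-or-leaf d b
    ... | inj₁ a<d | inj₁ b<d with <-cmp a b
    ...   | tri≈ _ a≡b _ = contradiction a≡b a≢b
    ...   | tri< a<b _ _ rewrite dist-path-path a<d b<d =
            suc a , ≤-<-trans a<b b<n , path-fwd refl (≤-<-trans a<b b<d) ,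
            trans (cong suc (dist-path-path (≤-<-trans a<b b<d) b<d)) (m<n⇒1+∣1+m-n∣≡∣m-n∣ a<b)
    closer-exists {n} {suc a} {b} a<n b<n _ | inj₁ a<d | inj₁ b<d | tri> _ _ (s≤s b≤a)
      rewrite dist-path-path a<d b<d =
            a , <-trans (n<1+n a) a<n , path-bwd refl a<d ,
            trans (cong suc (dist-path-path (<-trans (n<1+n a) a<d) b<d)) (sym (n≤m⇒∣1+m-n∣≡1+∣m-n∣ b≤a))
    closer-exists {a = zero} {b} _ b<n _ | inj₁ a<d | inj₂ d≤b rewrite dist-path-leaf a<d d≤b =
            b , b<n , leaf-out refl d≤b , cong suc (dist-refl {d} b)
    closer-exists {a = suc a} {b} a<n _ _ | inj₁ a<d | inj₂ d≤b rewrite dist-path-leaf a<d d≤b =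
            a , <-trans (n<1+n a) a<n , path-bwd refl a<d , cong suc (dist-path-leaf (<-trans (n<1+n a) a<d) d≤b)
    closer-exists a<n _ _ | inj₂ d≤a | inj₁ b<d rewrite dist-leaf-path d≤a b<d =
            0 , ≤-<-trans z≤n a<n , leaf-in d≤a refl , cong suc (dist-path-path 0<d b<d)
    closer-exists a<n _ a≢b | inj₂ d≤a | inj₂ d≤b rewrite dist-leaf-leaf d≤a d≤b a≢b =
            0 , ≤-<-trans z≤n a<n , leaf-in d≤a refl , cong suc (dist-path-leaf 0<d d≤b)

  module BroomDetour {n d : ℕ} (0<d : 0 < d) where

    δ : Fin n → Fin n → ℕ
    δ u v = dist d (toℕ u) (toℕ v)

    private
      closer-existsᶠ : ∀ {u v} → u ≢ v → ∃[ x ] Broom n d u x × suc (δ x v) ≡ δ u v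
      closer-existsᶠ {u} {v} u≢v with closer-exists 0<d (toℕ<n u) (toℕ<n v) (u≢v ∘ toℕ-injective)
      ... | x , x<n , ux , closer =
        fromℕ< x<n ,
        toBroomAdj (subst (Adj d (toℕ u)) (sym (toℕ-fromℕ< x<n)) ux) ,
        subst (λ y → suc (dist d y (toℕ v)) ≡ δ u v) (sym (toℕ-fromℕ< x<n)) closer

    open TreeDetour (Broom n d) δ
      (toBroomAdj ∘ Adj-sym ∘ fromBroomAdj)
      (λ v → dist-refl {d} (toℕ v))
      (λ ax v → dist-adjacent 0<d (fromBroomAdj ax) (toℕ v))
      (λ v ax aw x-closer w-closer → toℕ-injective (trans
        (closer⇒towards 0<d (fromBroomAdj ax) (toℕ v) x-closer)
        (sym (closer⇒towards 0<d (fromBroomAdj aw) (toℕ v) w-closer))))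
      closer-existsᶠ
      public using (isDetour; detour-unique)


  module _ {n d : ℕ} where

    HamiltonianByDist : (Fin n → ℕ) → Set
    HamiltonianByDist h = ∀ u v → u ≢ v → n ∸ 1 ≤ dist d (toℕ u) (toℕ v) + ∣ h u - h v ∣

    hamiltonianByDist? : ∀ h → Dec (HamiltonianByDist h)
    hamiltonianByDist? h = all? λ u → all? λ v →
      ¬? (u ≟ᶠ v) →-dec (n ∸ 1 ≤? dist d (toℕ u) (toℕ v) + ∣ h u - h v ∣)

    hamiltonian-by-dist : ∀ {h} → 0 < d → HamiltonianByDist h → IsHamiltonianColoring (Broom n d) h
    hamiltonian-by-dist 0<d ok u v u≢v m detour rewrite BroomDetour.detour-unique {n} 0<d detour = ok u v u≢v

  levelSum : ℕ → ℕ → ℕ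
  levelSum d m = sum (applyUpTo (level d) m)

  module _ {d : ℕ} where

    level-sum-path : ∀ m → m ≤ d → 2 * levelSum d m + m ≡ m * m
    level-sum-path zero    _   = refl
    level-sum-path (suc m) m<d = begin
      2 * levelSum d (suc m) + suc m          ≡⟨ cong (λ σ → 2 * σ + suc m) (sum-applyUpTo-suc (level d) m) ⟩
      2 * (levelSum d m + level d m) + suc m  ≡⟨ cong (λ l → 2 * (levelSum d m + l) + suc m) (level-path m<d) ⟩
      2 * (levelSum d m + m) + suc m          ≡⟨ split (levelSum d m) m ⟩
      (2 * levelSum d m + m) + (2 * m + 1)    ≡⟨ cong (_+ (2 * m + 1)) (level-sum-path m (<⇒≤ m<d)) ⟩
      m * m + (2 * m + 1)                     ≡⟨ square-suc m ⟩
      suc m * suc m                           ∎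
      where
      open ≡-Reasoning
      split : ∀ σ m → 2 * (σ + m) + suc m ≡ (2 * σ + m) + (2 * m + 1)
      split = solve-∀
      square-suc : ∀ m → m * m + (2 * m + 1) ≡ suc m * suc m
      square-suc = solve-∀

    level-sum-leaves : ∀ e → levelSum d (d + e) ≡ levelSum d d + e
    level-sum-leaves zero    = trans (cong (levelSum d) (+-identityʳ d)) (sym (+-identityʳ _))
    level-sum-leaves (suc e) = begin
      levelSum d (d + suc e)                ≡⟨ cong (levelSum d) (+-suc d e) ⟩
      levelSum d (suc (d + e))              ≡⟨ sum-applyUpTo-suc (level d) (d + e) ⟩
      levelSum d (d + e) + level d (d + e)  ≡⟨ cong₂ _+_ (level-sum-leaves e) (level-leaf (m≤m+n d e)) ⟩
      levelSum d d + e + 1                  ≡⟨ trans (+-assoc _ e 1) (cong (levelSum d d +_) (+-comm e 1)) ⟩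
      levelSum d d + suc e                  ∎
      where open ≡-Reasoning

    level-sum : ∀ {n} → d ≤ n → 2 * levelSum d n + 3 * d ≡ d * d + 2 * n
    level-sum {n} d≤n = begin
      2 * levelSum d n + 3 * d              ≡⟨ cong (λ m → 2 * levelSum d m + 3 * d) (sym (m+[n∸m]≡n d≤n)) ⟩
      2 * levelSum d (d + e) + 3 * d        ≡⟨ cong (λ σ → 2 * σ + 3 * d) (level-sum-leaves e) ⟩
      2 * (levelSum d d + e) + 3 * d        ≡⟨ split (levelSum d d) e d ⟩
      (2 * levelSum d d + d) + 2 * (d + e)  ≡⟨ cong₂ (λ x m → x + 2 * m) (level-sum-path d ≤-refl) (m+[n∸m]≡n d≤n) ⟩
      d * d + 2 * n                         ∎
      where
      open ≡-Reasoning
      e = n ∸ d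
      split : ∀ σ e d → 2 * (σ + e) + 3 * d ≡ (2 * σ + d) + 2 * (d + e)
      split = solve-∀

  -- s equals the lower bound (n-1)² + 1 - 2 Σ level, rearranged with
  -- 2 Σ level = d(d-1) + 2(n-d) so that no subtraction occurs.
  AttainsBound : ℕ → ℕ → ℕ → Set
  AttainsBound n d s = s + d * d + 4 * n ≡ n * n + 3 * d + 2

  module _ {n d : ℕ} (0<d : 0 < d) (d≤n : d ≤ n) (2≤n : 2 ≤ n) where

    private
      level≡0-unique : ∀ {a b : Fin n} → level d (toℕ a) ≡ 0 → level d (toℕ b) ≡ 0 → a ≡ b
      level≡0-unique {a} {b} a≡0 b≡0 =
        toℕ-injective (trans (level≡0⇒≡0 {d} (toℕ a) a≡0) (sym (level≡0⇒≡0 {d} (toℕ b) b≡0)))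

      open BroomDetour {n} 0<d
      open LowerBound (Broom n d) δ isDetour (level d ∘ toℕ)
        (λ a b → dist≤level+level {d} (toℕ a) (toℕ b)) level≡0-unique

      Σℓ≡ : Σℓ (allFin n) ≡ levelSum d n
      Σℓ≡ = cong sum (trans (map-tabulate id (level d ∘ toℕ)) (tabulate-toℕ n (level d)))

    broom-span-lower-bound : ∀ {h s} → IsHamiltonianColoring (Broom n d) h → IsSpan h s →
                             n * n + 3 * d + 2 ≤ s + d * d + 4 * n
    broom-span-lower-bound {h} {s} ham span = begin
      n * n + 3 * d + 2                          ≡⟨ square-shift ⟩
      suc ((n ∸ 1) * (n ∸ 1)) + (2 * n + 3 * d)  ≤⟨ +-monoˡ-≤ _ (span-lower-bound {h} ham 2≤n span) ⟩
      s + 2 * Σℓ (allFin n) + (2 * n + 3 * d)    ≡⟨ cong (λ x → s + 2 * x + (2 * n + 3 * d)) Σℓ≡ ⟩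
      s + 2 * σ + (2 * n + 3 * d)                ≡⟨ regroup s σ d n ⟩
      s + (2 * σ + 3 * d) + 2 * n                ≡⟨ cong (λ x → s + x + 2 * n) (level-sum d≤n) ⟩
      s + (d * d + 2 * n) + 2 * n                ≡⟨ collect s d n ⟩
      s + d * d + 4 * n                          ∎
      where
      open ≤-Reasoning
      σ = levelSum d n
      expand : ∀ m d → suc m * suc m + 3 * d + 2 ≡ suc (m * m) + (2 * suc m + 3 * d)
      expand = solve-∀
      square-shift : n * n + 3 * d + 2 ≡ suc ((n ∸ 1) * (n ∸ 1)) + (2 * n + 3 * d)
      square-shift = subst (λ k → k * k + 3 * d + 2 ≡ suc ((n ∸ 1) * (n ∸ 1)) + (2 * k + 3 * d))
                           (m+[n∸m]≡n (≤-trans (s≤s z≤n) 2≤n)) (expand (n ∸ 1) d)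
      regroup : ∀ s σ d n → s + 2 * σ + (2 * n + 3 * d) ≡ s + (2 * σ + 3 * d) + 2 * n
      regroup = solve-∀
      collect : ∀ s d n → s + (d * d + 2 * n) + 2 * n ≡ s + d * d + 4 * n
      collect = solve-∀

    attains-bound⇒isHc : ∀ {h s} → IsHamiltonianColoring (Broom n d) h → IsSpan h s →
                         AttainsBound n d s → IsHc (Broom n d) s
    attains-bound⇒isHc {h} {s} ham span attains = (h , ham , span) , minimal
      where
      minimal : ∀ h′ s′ → IsHamiltonianColoring (Broom n d) h′ → IsSpan h′ s′ → s ≤ s′
      minimal h′ s′ ham′ span′ = +-cancelʳ-≤ (d * d + 4 * n) s s′ (begin
        s + (d * d + 4 * n)   ≡⟨ trans (sym (+-assoc s _ _)) attains ⟩
        n * n + 3 * d + 2     ≤⟨ broom-span-lower-bound {h′} ham′ span′ ⟩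
        s′ + d * d + 4 * n    ≡⟨ +-assoc s′ _ _ ⟩
        s′ + (d * d + 4 * n)  ∎)
        where open ≤-Reasoning

  -- The colouring order of B_{n,d}: the path vertex m sits at position 2m and the leaf d+m
  -- at position 2m+1 (m < d), followed by the remaining leaves in increasing order.
  interleave : ℕ → ℕ → ℕ
  interleave d zero          = 0
  interleave d (suc zero)    = d
  interleave d (suc (suc p)) = suc (interleave d p)

  order : ℕ → ℕ → ℕ
  order d p with p <? d + d
  ... | yes _ = interleave d p
  ... | no _  = p

  position : ℕ → ℕ → ℕ
  position d a with a <? d | a <? d + d
  ... | yes _ | _     = a + a
  ... | no _  | yes _ = suc ((a ∸ d) + (a ∸ d))
  ... | no _  | no _  = a

  module _ {d : ℕ} where

    private
      double< : ∀ {m} → m < d → m + m < d + d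
      double< m<d = +-mono-< m<d m<d

      double+1< : ∀ {m} → m < d → suc (m + m) < d + d
      double+1< {m} m<d = subst (_≤ d + d) (cong suc (+-suc m m)) (+-mono-≤ m<d m<d)

      leaf-index< : ∀ {a} → d ≤ a → a < d + d → a ∸ d < d
      leaf-index< d≤a a<2d = +-cancelˡ-< d _ d (subst (_< d + d) (sym (m+[n∸m]≡n d≤a)) a<2d)

    order-even : ∀ {m} → m < d → order d (m + m) ≡ m
    order-even {m} m<d with m + m <? d + d
    ... | no m+m≮2d = contradiction (double< m<d) m+m≮2d
    ... | yes _     = interleave-even m
      where
      interleave-even : ∀ m → interleave d (m + m) ≡ m
      interleave-even zero = refl
      interleave-even (suc m) rewrite +-suc m m = cong suc (interleave-even m)

    order-odd : ∀ {m} → m < d → order d (suc (m + m)) ≡ d + m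
    order-odd {m} m<d with suc (m + m) <? d + d
    ... | no m+m+1≮2d = contradiction (double+1< m<d) m+m+1≮2d
    ... | yes _       = interleave-odd m
      where
      interleave-odd : ∀ m → interleave d (suc (m + m)) ≡ d + m
      interleave-odd zero = sym (+-identityʳ d)
      interleave-odd (suc m) rewrite +-suc m m | +-suc d m = cong suc (interleave-odd m)

    order-beyond : ∀ {p} → d + d ≤ p → order d p ≡ p
    order-beyond {p} 2d≤p with p <? d + d
    ... | yes p<2d = contradiction 2d≤p (<⇒≱ p<2d)
    ... | no _     = refl

    order-position : ∀ a → order d (position d a) ≡ a
    order-position a with a <? d | a <? d + d
    ... | yes a<d | _        = order-even a<d
    ... | no a≮d  | yes a<2d = trans (order-odd (leaf-index< (≮⇒≥ a≮d) a<2d)) (m+[n∸m]≡n (≮⇒≥ a≮d))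
    ... | no _    | no a≮2d  = order-beyond (≮⇒≥ a≮2d)

    position< : ∀ {n a} → d + d ≤ n → a < n → position d a < n
    position< {a = a} 2d≤n a<n with a <? d | a <? d + d
    ... | yes a<d | _        = <-≤-trans (double< a<d) 2d≤n
    ... | no a≮d  | yes a<2d = <-≤-trans (double+1< (leaf-index< (≮⇒≥ a≮d) a<2d)) 2d≤n
    ... | no _    | no _     = a<n

    position-beyond : ∀ {a} → d + d ≤ a → position d a ≡ a
    position-beyond {a} 2d≤a with a <? d | a <? d + d
    ... | yes a<d | _        = contradiction 2d≤a (<⇒≱ (<-≤-trans a<d (m≤m+n d d)))
    ... | no _    | yes a<2d = contradiction 2d≤a (<⇒≱ a<2d)
    ... | no _    | no _     = refl

  -- Colour the vertices in the above order, leaving a gap of (n-1) - D between consecutive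
  -- vertices at distance D.  Two vertices that are not consecutive are separated by two gaps
  -- of at least (n-1) - d each, which is enough as soon as n > 2d.
  module Colouring (d′ e : ℕ) (1≤d′ : 1 ≤ d′) where

    d : ℕ
    d = suc d′

    n-1 : ℕ
    n-1 = d + d + e

    n : ℕ
    n = suc n-1

    private
      0<d : 0 < d
      0<d = s≤s z≤n

      2≤d : 2 ≤ d
      2≤d = s≤s 1≤d′

    D : ℕ → ℕ
    D p = dist d (order d p) (order d (suc p))

    gap : ℕ → ℕ
    gap p = n-1 ∸ D p

    colour : ℕ → ℕ
    colour zero    = 0
    colour (suc p) = colour p + gap p

    ΣD : ℕ → ℕ
    ΣD zero    = 0
    ΣD (suc p) = ΣD p + D p

    colour-mono : ∀ {p q} → p ≤ q → colour p ≤ colour q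
    colour-mono {p} {q} p≤q with m≤n⇒∃[o]m+o≡n p≤q
    ... | o , refl = increase p o
      where
      increase : ∀ p o → colour p ≤ colour (p + o)
      increase p zero    = ≤-reflexive (cong colour (sym (+-identityʳ p)))
      increase p (suc o) = ≤-trans (increase p o)
        (subst (colour (p + o) ≤_) (cong colour (sym (+-suc p o))) (m≤m+n (colour (p + o)) _))

    gap≥ : ∀ p → d + e ≤ gap p
    gap≥ p = ≤-trans (≤-reflexive (sym (trans (cong (_∸ d) (+-assoc d d e)) (m+n∸m≡n d (d + e)))))
                     (∸-monoʳ-≤ n-1 (dist≤d 2≤d (order d p) (order d (suc p))))

    colour-far : ∀ {p q} → suc (suc p) ≤ q → colour p + n-1 ≤ colour q
    colour-far {p} {q} 2+p≤q = begin
      colour p + n-1                    ≤⟨ +-monoʳ-≤ (colour p) (subst (n-1 ≤_) (regroup d e) (m≤m+n n-1 e)) ⟩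
      colour p + ((d + e) + (d + e))    ≤⟨ +-monoʳ-≤ (colour p) (+-mono-≤ (gap≥ p) (gap≥ (suc p))) ⟩
      colour p + (gap p + gap (suc p))  ≡⟨ sym (+-assoc (colour p) _ _) ⟩
      colour (suc (suc p))              ≤⟨ colour-mono 2+p≤q ⟩
      colour q                          ∎
      where
      open ≤-Reasoning
      regroup : ∀ d e → d + d + e + e ≡ (d + e) + (d + e)
      regroup = solve-∀

    separated : ∀ {p q} → p < q → n-1 ≤ dist d (order d p) (order d q) + ∣ colour p - colour q ∣
    separated {p} {q} p<q rewrite m≤n⇒∣m-n∣≡n∸m (colour-mono (<⇒≤ p<q)) with suc p ≟ q
    ... | yes refl rewrite m+n∸m≡n (colour p) (gap p) = m≤n+m∸n n-1 (D p)
    ... | no 1+p≢q = ≤-trans far (m≤n+m _ _)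
      where
      far : n-1 ≤ colour q ∸ colour p
      far = +-cancelˡ-≤ (colour p) _ _
        (subst (colour p + n-1 ≤_) (sym (m+[n∸m]≡n (colour-mono (<⇒≤ p<q)))) (colour-far (≤∧≢⇒< p<q 1+p≢q)))

    h : Fin n → ℕ
    h u = colour (position d (toℕ u))

    isHamiltonianColoring : IsHamiltonianColoring (Broom n d) h
    isHamiltonianColoring = hamiltonian-by-dist {h = h} 0<d separated-vertices
      where
      separated-vertices : HamiltonianByDist {n} {d} h
      separated-vertices u v u≢v with <-cmp (position d (toℕ u)) (position d (toℕ v))
      ... | tri< pu<pv _ _ =
        subst (λ δ → n-1 ≤ δ + ∣ h u - h v ∣)
          (cong₂ (dist d) (order-position {d} (toℕ u)) (order-position {d} (toℕ v))) (separated pu<pv)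
      ... | tri> _ _ pv<pu =
        subst₂ (λ δ c → n-1 ≤ δ + c)
          (trans (cong₂ (dist d) (order-position {d} (toℕ v)) (order-position {d} (toℕ u))) (dist-sym {d} (toℕ v) (toℕ u)))
          (∣-∣-comm (h v) (h u)) (separated pv<pu)
      ... | tri≈ _ pu≡pv _ = contradiction (toℕ-injective (begin
          toℕ u                         ≡⟨ sym (order-position {d} (toℕ u)) ⟩
          order d (position d (toℕ u))  ≡⟨ cong (order d) pu≡pv ⟩
          order d (position d (toℕ v))  ≡⟨ order-position {d} (toℕ v) ⟩
          toℕ v                         ∎)) u≢v
        where open ≡-Reasoning

    isSpan : IsSpan h (colour n-1)
    isSpan = (λ u v → ≤-trans (∣m-n∣≤m⊔n (h u) (h v)) (⊔-lub (h≤ u) (h≤ v))) ,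
             fzero , fromℕ n-1 ,
             cong colour (trans (cong (position d) (toℕ-fromℕ n-1)) (position-beyond {d} (m≤m+n (d + d) e)))
      where
      h≤ : ∀ u → h u ≤ colour n-1
      h≤ u = colour-mono (s≤s⁻¹ (position< {d} (≤-trans (m≤m+n (d + d) e) (n≤1+n n-1)) (toℕ<n u)))

    colour+ΣD : ∀ p → colour p + ΣD p ≡ p * n-1
    colour+ΣD zero    = refl
    colour+ΣD (suc p) = begin
      colour p + gap p + (ΣD p + D p)    ≡⟨ regroup (colour p) (gap p) (ΣD p) (D p) ⟩
      (gap p + D p) + (colour p + ΣD p)  ≡⟨ cong₂ _+_ (m∸n+n≡m D≤n-1) (colour+ΣD p) ⟩
      n-1 + p * n-1                      ∎
      where
      open ≡-Reasoning
      regroup : ∀ c g σ δ → c + g + (σ + δ) ≡ (g + δ) + (c + σ)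
      regroup = solve-∀
      D≤n-1 : D p ≤ n-1
      D≤n-1 = ≤-trans (dist≤d 2≤d (order d p) (order d (suc p))) (≤-trans (m≤m+n d d) (m≤m+n (d + d) e))

    -- Consecutive vertices of the order are joined through the root, which makes the
    -- lower bound tight.
    D-even : ∀ {m} → m < d → D (m + m) ≡ suc m
    D-even {m} m<d rewrite order-even {d} m<d | order-odd {d} m<d = dist-path-leaf m<d (m≤m+n d m)

    D-odd : ∀ {m} → suc m < d → D (suc (m + m)) ≡ suc (suc m)
    D-odd {m} 1+m<d rewrite order-odd {d} (<-trans (n<1+n m) 1+m<d) | sym (+-suc m m)
                          | order-even {d} 1+m<d = dist-leaf-path (m≤m+n d m) 1+m<d

    order-tail : ∀ {q} → suc (d′ + d′) ≤ q → order d q ≡ q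
    order-tail {q} 2d-1≤q with q ≟ suc (d′ + d′)
    ... | yes refl  = order-odd {d} (n<1+n d′)
    ... | no q≢2d-1 = order-beyond {d}
      (subst (_≤ q) (cong suc (sym (+-suc d′ d′))) (≤∧≢⇒< 2d-1≤q (q≢2d-1 ∘ sym)))

    D-leaves : ∀ {p} → suc (d′ + d′) ≤ p → D p ≡ 2
    D-leaves {p} 2d-1≤p rewrite order-tail 2d-1≤p | order-tail (m≤n⇒m≤1+n 2d-1≤p) =
      dist-leaf-leaf d≤p (m≤n⇒m≤1+n d≤p) (1+n≢n ∘ sym)
      where
      d≤p : d ≤ p
      d≤p = ≤-trans (s≤s (m≤m+n d′ d′)) 2d-1≤p

    ΣD-path : ∀ {m} → m ≤ d′ → ΣD (m + m) ≡ m * m + (m + m)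
    ΣD-path {zero}  _     = refl
    ΣD-path {suc m} m<d′ = begin
      ΣD (suc m + suc m)                        ≡⟨ cong (ΣD ∘ suc) (+-suc m m) ⟩
      ΣD (m + m) + D (m + m) + D (suc (m + m))  ≡⟨ cong₂ (λ x y → x + y) (cong₂ _+_ (ΣD-path (<⇒≤ m<d′)) (D-even (<-trans m<d′ (n<1+n d′)))) (D-odd (s≤s m<d′)) ⟩
      m * m + (m + m) + suc m + suc (suc m)     ≡⟨ square-step m ⟩
      suc m * suc m + (suc m + suc m)           ∎
      where
      open ≡-Reasoning
      square-step : ∀ m → m * m + (m + m) + suc m + suc (suc m) ≡ suc m * suc m + (suc m + suc m)
      square-step = solve-∀

    ΣD-tail : ∀ f → ΣD (suc (d′ + d′) + f) ≡ ΣD (suc (d′ + d′)) + 2 * f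
    ΣD-tail zero    = trans (cong ΣD (+-identityʳ (suc (d′ + d′)))) (sym (+-identityʳ _))
    ΣD-tail (suc f) = begin
      ΣD (suc (d′ + d′) + suc f)                      ≡⟨ cong ΣD (+-suc (suc (d′ + d′)) f) ⟩
      ΣD (suc (d′ + d′) + f) + D (suc (d′ + d′) + f)  ≡⟨ cong₂ _+_ (ΣD-tail f) (D-leaves (m≤m+n _ f)) ⟩
      ΣD (suc (d′ + d′)) + 2 * f + 2                  ≡⟨ +-two (ΣD (suc (d′ + d′))) f ⟩
      ΣD (suc (d′ + d′)) + 2 * suc f                  ∎
      where
      open ≡-Reasoning
      +-two : ∀ σ f → σ + 2 * f + 2 ≡ σ + 2 * suc f
      +-two = solve-∀

    ΣD-total : ΣD n-1 + 3 * d + 1 ≡ d * d + 2 * n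
    ΣD-total = begin
      ΣD n-1 + 3 * d + 1                                  ≡⟨ cong (λ p → ΣD p + 3 * d + 1) (split d′ e) ⟩
      ΣD (suc (d′ + d′) + suc e) + 3 * d + 1              ≡⟨ cong (λ σ → σ + 3 * d + 1) (ΣD-tail (suc e)) ⟩
      ΣD (d′ + d′) + D (d′ + d′) + 2 * suc e + 3 * d + 1  ≡⟨ cong₂ (λ σ δ → σ + δ + 2 * suc e + 3 * d + 1) (ΣD-path ≤-refl) (D-even (n<1+n d′)) ⟩
      d′ * d′ + (d′ + d′) + d + 2 * suc e + 3 * d + 1     ≡⟨ expand d′ e ⟩
      d * d + 2 * n                                       ∎
      where
      open ≡-Reasoning
      split : ∀ d′ e → suc d′ + suc d′ + e ≡ suc (d′ + d′) + suc e
      split = solve-∀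
      expand : ∀ d′ e → d′ * d′ + (d′ + d′) + suc d′ + 2 * suc e + 3 * suc d′ + 1
                      ≡ suc d′ * suc d′ + 2 * suc (suc d′ + suc d′ + e)
      expand = solve-∀

    attainsBound : AttainsBound n d (colour n-1)
    attainsBound = begin
      colour n-1 + d * d + 4 * n                 ≡⟨ split (colour n-1) d n ⟩
      colour n-1 + (d * d + 2 * n) + 2 * n       ≡⟨ cong (λ x → colour n-1 + x + 2 * n) (sym ΣD-total) ⟩
      colour n-1 + (ΣD n-1 + 3 * d + 1) + 2 * n  ≡⟨ regroup (colour n-1) (ΣD n-1) d n ⟩
      (colour n-1 + ΣD n-1) + 3 * d + 1 + 2 * n  ≡⟨ cong (λ x → x + 3 * d + 1 + 2 * n) (colour+ΣD n-1) ⟩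
      n-1 * n-1 + 3 * d + 1 + 2 * n              ≡⟨ square n-1 d ⟩
      n * n + 3 * d + 2                          ∎
      where
      open ≡-Reasoning
      split : ∀ c d n → c + d * d + 4 * n ≡ c + (d * d + 2 * n) + 2 * n
      split = solve-∀
      regroup : ∀ c σ d n → c + (σ + 3 * d + 1) + 2 * n ≡ (c + σ) + 3 * d + 1 + 2 * n
      regroup = solve-∀
      square : ∀ g d → g * g + 3 * d + 1 + 2 * suc g ≡ suc g * suc g + 3 * d + 2
      square = solve-∀

  broom-hc : ∀ {n d} → 2 ≤ d → 2 * d < n → Σ ℕ λ s → IsHc (Broom n d) s × AttainsBound n d s
  broom-hc {N} {suc d′} (s≤s 1≤d′) 2d<N =
    subst (λ n → Σ ℕ λ s → IsHc (Broom n d) s × AttainsBound n d s) n≡N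
      (colour n-1 , attains-bound⇒isHc 0<d d≤n 2≤n {h} isHamiltonianColoring isSpan attainsBound , attainsBound)
    where
    e = N ∸ suc (2 * suc d′)
    open Colouring d′ e 1≤d′
    0<d : 0 < d
    0<d = s≤s z≤n
    d≤n : d ≤ n
    d≤n = ≤-trans (m≤m+n d d) (≤-trans (m≤m+n (d + d) _) (n≤1+n n-1))
    2≤n : 2 ≤ n
    2≤n = ≤-trans (s≤s 1≤d′) d≤n
    n≡N : n ≡ N
    n≡N = trans (cong (λ x → suc (x + e)) (sym (cong (d +_) (+-identityʳ d)))) (m+[n∸m]≡n 2d<N)

  isHc-by-computation : ∀ {n d} (h : Fin n → ℕ) s (u v : Fin n) → 0 < d → d ≤ n → 2 ≤ n →
                        True (hamiltonianByDist? {n} {d} h) →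
                        True (all? λ u → all? λ v → ∣ h u - h v ∣ ≤? s) →
                        ∣ h u - h v ∣ ≡ s → AttainsBound n d s → IsHc (Broom n d) s
  isHc-by-computation h s u v 0<d d≤n 2≤n ham? bounded? extremal attains =
    attains-bound⇒isHc 0<d d≤n 2≤n {h} (hamiltonian-by-dist {h = h} 0<d (toWitness ham?))
      (toWitness bounded? , u , v , extremal) attains

  -- B_{3,2} and B_{6,3} have n = 2d, too few leaves for broom-hc; the same colouring
  -- order still works and is checked exhaustively.
  hc-B₃,₂ : Σ ℕ λ s → IsHc (Broom 3 2) s × AttainsBound 3 2 s
  hc-B₃,₂ = 1 , isHc-by-computation (lookup (0 ∷ 1 ∷ 1 ∷ [])) 1 fzero (fromℕ 2)
                  (s≤s z≤n) (s≤s (s≤s z≤n)) (s≤s (s≤s z≤n)) _ _ refl refl , refl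

  hc-B₆,₃ : Σ ℕ λ s → IsHc (Broom 6 3) s × AttainsBound 6 3 s
  hc-B₆,₃ = 14 , isHc-by-computation (lookup (0 ∷ 7 ∷ 12 ∷ 4 ∷ 10 ∷ 14 ∷ [])) 14 fzero (fromℕ 5)
                   (s≤s z≤n) (s≤s (s≤s (s≤s z≤n))) (s≤s (s≤s z≤n)) _ _ refl refl , refl

  hc-B-even : ∀ k → k ≥ 1 → Σ ℕ λ s → IsHc (B-even k) s × AttainsBound (k * (2 * k + 1)) (2 * k) s
  hc-B-even (suc zero)    _ = hc-B₃,₂
  hc-B-even (suc (suc j)) _ = broom-hc (s≤s (s≤s z≤n)) (subst (suc (2 * d) ≤_) (sym (spare j)) (m≤m+n _ _))
    where
    d = 2 * suc (suc j)
    spare : ∀ j → (2 + j) * (2 * (2 + j) + 1) ≡ suc (2 * (2 * (2 + j))) + (2 * j * j + 5 * j + 1)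
    spare = solve-∀

  hc-B-odd : ∀ k → k ≥ 1 → Σ ℕ λ s → IsHc (B-odd k) s × AttainsBound ((k + 1) * (2 * k + 1)) (2 * k + 1) s
  hc-B-odd (suc zero)    _ = hc-B₆,₃
  hc-B-odd (suc (suc j)) _ = broom-hc (s≤s (s≤s z≤n)) (subst (suc (2 * d) ≤_) (sym (spare j)) (m≤m+n _ _))
    where
    d = 2 * suc (suc j) + 1
    spare : ∀ j → (2 + j + 1) * (2 * (2 + j) + 1) ≡ suc (2 * (2 * (2 + j) + 1)) + (2 * j * j + 7 * j + 4)
    spare = solve-∀

open Brooms using (AttainsBound; hc-B-even; hc-B-odd)

import Data.Nat as ℕ
open import Data.Nat using (ℕ; _≥_)
open import Data.Integer using (ℤ; +_; _+_; _-_; _*_)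
open import Data.Integer.Properties using (pos-+; pos-*)
open import Data.Integer.Tactic.RingSolver using (solve-∀)
open import Data.Product using (Σ; _×_; _,_)
open import Relation.Binary.PropositionalEquality using (_≡_; sym; cong; cong₂; trans)

attains-bound-ℤ : ∀ {n d s} → AttainsBound n d s →
                  + s ≡ + n * + n + + 3 * + d + + 2 - + d * + d - + 4 * + n
attains-bound-ℤ {n} {d} {s} attains =
  trans (add-sub (+ s) (+ d * + d) (+ 4 * + n))
        (cong (λ z → z - + d * + d - + 4 * + n) (trans (sym lhs-cast) (trans (cong +_ attains) rhs-cast)))
  where
  add-sub : ∀ a b c → a ≡ a + b + c - b - c
  add-sub = solve-∀
  lhs-cast : + (s ℕ.+ d ℕ.* d ℕ.+ 4 ℕ.* n) ≡ + s + + d * + d + + 4 * + n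
  lhs-cast = trans (pos-+ (s ℕ.+ d ℕ.* d) (4 ℕ.* n))
                   (cong₂ _+_ (trans (pos-+ s (d ℕ.* d)) (cong (λ z → + s + z) (pos-* d d))) (pos-* 4 n))
  rhs-cast : + (n ℕ.* n ℕ.+ 3 ℕ.* d ℕ.+ 2) ≡ + n * + n + + 3 * + d + + 2
  rhs-cast = trans (pos-+ (n ℕ.* n ℕ.+ 3 ℕ.* d) 2)
                   (cong (_+ + 2) (trans (pos-+ (n ℕ.* n) (3 ℕ.* d)) (cong₂ _+_ (pos-* n n) (pos-* 3 d))))

pos-2k+1 : ∀ k → + (2 ℕ.* k ℕ.+ 1) ≡ + 2 * + k + + 1
pos-2k+1 k = trans (pos-+ (2 ℕ.* k) 1) (cong (_+ + 1) (pos-* 2 k))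

hc-B-even-ℤ : ∀ k {s} → AttainsBound (k ℕ.* (2 ℕ.* k ℕ.+ 1)) (2 ℕ.* k) s →
  + s ≡ (+ 2 * + k) * ((+ 2 * + k * + k * + k) + (+ 2 * + k * + k) + + 1) - + 11 * + k * + k + + 2
hc-B-even-ℤ k attains = trans (attains-bound-ℤ {k ℕ.* (2 ℕ.* k ℕ.+ 1)} {2 ℕ.* k} attains) (trans
  (cong₂ (λ N D → N * N + + 3 * D + + 2 - D * D - + 4 * N)
         (trans (pos-* k _) (cong (λ z → + k * z) (pos-2k+1 k))) (pos-* 2 k))
  (closed-form (+ k)))
  where
  closed-form : ∀ K → K * (+ 2 * K + + 1) * (K * (+ 2 * K + + 1)) + + 3 * (+ 2 * K) + + 2
                      - + 2 * K * (+ 2 * K) - + 4 * (K * (+ 2 * K + + 1))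
                    ≡ (+ 2 * K) * ((+ 2 * K * K * K) + (+ 2 * K * K) + + 1) - + 11 * K * K + + 2
  closed-form = solve-∀

hc-B-odd-ℤ : ∀ k {s} → AttainsBound ((k ℕ.+ 1) ℕ.* (2 ℕ.* k ℕ.+ 1)) (2 ℕ.* k ℕ.+ 1) s →
  + s ≡ (+ 2 * + k + + 1) * ((+ 2 * + k * + k * + k) + (+ 5 * + k * + k) - + 2 * + k - + 1) + + 2
hc-B-odd-ℤ k attains = trans (attains-bound-ℤ {(k ℕ.+ 1) ℕ.* (2 ℕ.* k ℕ.+ 1)} {2 ℕ.* k ℕ.+ 1} attains) (trans
  (cong₂ (λ N D → N * N + + 3 * D + + 2 - D * D - + 4 * N)
         (trans (pos-* (k ℕ.+ 1) _) (cong₂ _*_ (pos-+ k 1) (pos-2k+1 k))) (pos-2k+1 k))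
  (closed-form (+ k)))
  where
  closed-form : ∀ K → (K + + 1) * (+ 2 * K + + 1) * ((K + + 1) * (+ 2 * K + + 1)) + + 3 * (+ 2 * K + + 1) + + 2
                      - (+ 2 * K + + 1) * (+ 2 * K + + 1) - + 4 * ((K + + 1) * (+ 2 * K + + 1))
                    ≡ (+ 2 * K + + 1) * ((+ 2 * K * K * K) + (+ 5 * K * K) - + 2 * K - + 1) + + 2
  closed-form = solve-∀

theorem5 : (k : ℕ) → k ≥ 1 →
    (Σ ℕ λ s → IsHc (B-even k) s ×
      + s ≡ (+ 2 * + k) * ((+ 2 * + k * + k * + k) + (+ 2 * + k * + k) + + 1) - + 11 * + k * + k + + 2)
    × (Σ ℕ λ s → IsHc (B-odd k) s ×
      + s ≡ (+ 2 * + k + + 1) * ((+ 2 * + k * + k * + k) + (+ 5 * + k * + k) - + 2 * + k - + 1) + + 2)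
theorem5 k k≥1 with hc-B-even k k≥1 | hc-B-odd k k≥1
... | s , hc , attains | s′ , hc′ , attains′ = (s , hc , hc-B-even-ℤ k attains) , (s′ , hc′ , hc-B-odd-ℤ k attains′)
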